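{- Let $\lambda$ be the map defined on $BP_2(n)$ as follows: for $\sigma\in BP_2(n)$ with set of weak exceedances $\{1,\dots,k\}$, $\lambda(\sigma)$ is the collection of blocks $B_1,\dots,B_k$ obtained by (1) for every weak exceedance $i$ (so $\sigma(i)\ge i$), putting $\sigma(i)$ into $B_i$, and (2) for every $x\in[n]$ that is not a weak exceedance letter (i.e. not of the form $\sigma(i)$ with $i$ a weak exceedance), putting $x$ into $B_{\mathrm{inom}(x)}$. Then $\lambda$ is a bijection from $BP_2(n)$ onto the set $\mathfrak{P}(n)$ of set partitions of $[n]$.
   Context: $\mathfrak{S}_n$ is the symmetric group on $[n]$. A weak exceedance of $\sigma$ is a position $i$ with $\sigma(i)\ge i$. For $\sigma\in\mathfrak{S}_n$ and $i\in[n]$, $\mathrm{inom}(i)=\sigma^{ -t}(i)$ where $t\ge1$ is the smallest positive integer with $\sigma^{ -t}(i)\le i$. The inom code of $\sigma$ is $f=f_1\cdots f_n$ with $f_i=\mathrm{inom}(i)$ (equivalently the unique subexceedant function with $\sigma=(n\ f_n)\cdots(1\ f_1)$, leftmost transposition acting first). $BP_2(n)$ is the set of $\sigma\in\mathfrak{S}_n$ whose inom code satisfies: for every $i\in[n]$, $\{f_1,\dots,f_i\}$ is an integer interval; for such $\sigma$ the set of weak exceedances is $\{1,\dots,k\}$ for some $k$. -}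

module Defs where

open import Data.Nat using (ℕ; zero; suc; _≤_; _≤?_)
open import Data.Fin using (Fin; toℕ; _≟_)
open import Data.Fin.Properties using (any?)
open import Data.Fin.Permutation using (Permutation′; _⟨$⟩ʳ_; _⟨$⟩ˡ_)
open import Data.Fin.Subset using (Subset; _∈_; Nonempty)
open import Data.Bool using (Bool; _∨_; _∧_; not)
open import Data.Vec using (tabulate)
open import Data.List using (List; map; filter; allFin; lookup; length)
import Data.List.Relation.Unary.All as All
import Data.List.Relation.Unary.Any as Any
import Data.List.Membership.Propositional as LM
open import Data.Product using (Σ; ∃; _×_; _,_)
open import Relation.Nullary using (Dec; yes; no)
open import Relation.Nullary.Decidable using (⌊_⌋; _×-dec_)
open import Relation.Binary.PropositionalEquality using (_≡_)

-- Permutations of [n] are modelled by Fin n (0-based: position i ∈ Fin n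
-- stands for i+1 ∈ [n]); σ(i) = σ ⟨$⟩ʳ i, σ⁻¹(i) = σ ⟨$⟩ˡ i.

WeakExc : ∀ {n} → Permutation′ n → Fin n → Set
WeakExc σ i = toℕ i ≤ toℕ (σ ⟨$⟩ʳ i)

weakExc? : ∀ {n} (σ : Permutation′ n) (i : Fin n) → Dec (WeakExc σ i)
weakExc? σ i = toℕ i ≤? toℕ (σ ⟨$⟩ʳ i)

-- inom(i) = σ^{-t}(i) for the least t ≥ 1 with σ^{-t}(i) ≤ i.
-- Search iterates y ↦ σ⁻¹ y starting at i, t = 1,2,…; fuel n suffices since
-- σ^{-t}(i) = i for t the length of the cycle of i (≤ n). (Fallback unreachable.)
inomAux : ∀ {n} → Permutation′ n → Fin n → ℕ → Fin n → Fin n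
inomAux σ i zero y = i
inomAux σ i (suc fuel) y with toℕ (σ ⟨$⟩ˡ y) ≤? toℕ i
... | yes _ = σ ⟨$⟩ˡ y
... | no _  = inomAux σ i fuel (σ ⟨$⟩ˡ y)

inom : ∀ {n} → Permutation′ n → Fin n → Fin n
inom {n} σ i = inomAux σ i n i

inomCode : ∀ {n} → Permutation′ n → Fin n → Fin n
inomCode = inom

IsIntervalPrefix : ∀ {n} → (Fin n → Fin n) → Fin n → Set
IsIntervalPrefix {n} f i =
  ∀ (j j′ : Fin n) (c : Fin n) → toℕ j ≤ toℕ i → toℕ j′ ≤ toℕ i →
  toℕ (f j) ≤ toℕ c → toℕ c ≤ toℕ (f j′) →
  ∃ λ (j″ : Fin n) → toℕ j″ ≤ toℕ i × f j″ ≡ c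

InBP2 : ∀ {n} → Permutation′ n → Set
InBP2 {n} σ = ∀ (i : Fin n) → IsIntervalPrefix (inomCode σ) i

WELetter : ∀ {n} → Permutation′ n → Fin n → Set
WELetter σ x = ∃ λ i → WeakExc σ i × σ ⟨$⟩ʳ i ≡ x

weLetter? : ∀ {n} (σ : Permutation′ n) (x : Fin n) → Dec (WELetter σ x)
weLetter? σ x = any? (λ i → weakExc? σ i ×-dec (σ ⟨$⟩ʳ i ≟ x))

block : ∀ {n} → Permutation′ n → Fin n → Subset n
block σ i = tabulate λ x →
  ⌊ x ≟ σ ⟨$⟩ʳ i ⌋ ∨ (not ⌊ weLetter? σ x ⌋ ∧ ⌊ inom σ x ≟ i ⌋)

lam : ∀ {n} → Permutation′ n → List (Subset n)
lam {n} σ = map (block σ) (filter (weakExc? σ) (allFin n))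

record IsSetPartition {n : ℕ} (P : List (Subset n)) : Set where
  field
    nonempty : All.All Nonempty P
    covers   : ∀ (x : Fin n) → Any.Any (x ∈_) P
    disjoint : ∀ (x : Fin n) (p q : Fin (length P)) →
               x ∈ lookup P p → x ∈ lookup P q → p ≡ q

SamePartition : ∀ {n} → List (Subset n) → List (Subset n) → Set
SamePartition P Q = (∀ B → B LM.∈ P → B LM.∈ Q) × (∀ B → B LM.∈ Q → B LM.∈ P)

module Submission where

-- Write p = σ⁻¹ on ℕ. Then inom x is the first point of the orbit p x, p² x, … that is ≤ x.
-- A weak-exceedance letter σ i has inom (σ i) = i, and inom x is always a weak exceedance, so
-- x lies in B_i exactly when inom x = i: λ(σ) is the partition of [n] into the fibres of inom.
-- Injectivity: the first returns determine p (cut the top point n-1 out of its cycle and induct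
-- on n), so σ is determined by its inom code. For σ ∈ BP₂ the code is subexceedant with interval
-- prefixes, so each new value is the next integer, and such a code is determined by its fibres.
-- Surjectivity: number the blocks of a partition 0, 1, 2, … by their least elements. This code f
-- is subexceedant, and for σ⁻¹ = (n f_n)⋯(1 f_1) the first returns are exactly f, so inom σ = f;
-- hence σ ∈ BP₂ and λ(σ) is the given partition.

open import Defs
open import Data.Nat using (ℕ; zero; suc; _+_; _∸_; _≤_; _<_; _≤′_; ≤′-refl; ≤′-step; _≤?_; _<?_; _≟_; z≤n; s≤s; s≤s⁻¹)
open import Data.Nat.Properties
open import Data.Nat.GeneralisedArithmetic using (iterate)
open import Data.Fin as Fin using (Fin; toℕ; fromℕ<)
open import Data.Fin.Properties using (pigeonhole; toℕ-fromℕ<; fromℕ<-toℕ; toℕ<n; toℕ-injective; any?)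
open import Data.Fin.Induction using (<-wellFounded)
open import Data.Fin.Subset using (Subset; _∈_)
open import Data.Fin.Subset.Properties using (⊆-antisym)
open import Data.Fin.Permutation using (Permutation′; permutation; _⟨$⟩ʳ_; _⟨$⟩ˡ_; inverseˡ; inverseʳ)
open import Data.Bool using (Bool; true; _∨_; _∧_; not)
open import Data.Vec using (tabulate)
open import Data.Vec.Properties using (lookup∘tabulate; []=⇒lookup; lookup⇒[]=)
open import Data.List using (List; _∷_; map; filter; allFin; lookup; length)
import Data.List.Relation.Unary.All as All
import Data.List.Relation.Unary.All.Properties as All
import Data.List.Relation.Unary.Any as Any
import Data.List.Relation.Unary.Any.Properties as Any
open import Data.List.Relation.Unary.Any using (here; there)
open import Data.List.Relation.Unary.AllPairs using (_∷_)
open import Data.List.Membership.Propositional using (lose) renaming (_∈_ to _∈ₗ_)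
open import Data.List.Membership.Propositional.Properties using (∈-filter⁺; ∈-filter⁻; ∈-allFin; ∈-map⁺; ∈-map⁻; ∈-lookup)
open import Data.List.Relation.Unary.Unique.Propositional using (Unique)
open import Data.List.Relation.Unary.Unique.Propositional.Properties using (allFin⁺; filter⁺; Unique[x∷xs]⇒x∉xs)
open import Data.Empty using (⊥; ⊥-elim)
open import Data.Product using (∃; ∃₂; _×_; _,_; proj₁; proj₂; map₁; map₂; swap)
open import Data.Sum using (_⊎_; inj₁; inj₂)
open import Function using (_∘_; case_of_)
import Induction.WellFounded as WF
open import Relation.Binary.Definitions using (tri<; tri≈; tri>)
open import Relation.Binary.PropositionalEquality
open import Relation.Nullary using (Dec; yes; no; ¬_)
open import Relation.Nullary.Decidable using (⌊_⌋; _×-dec_)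
open import Relation.Nullary.Negation using (contradiction)

-- First returns of a map on ℕ

MapsInto : ℕ → (ℕ → ℕ) → Set
MapsInto n p = ∀ {y} → y < n → p y < n

InjectiveBelow : ℕ → (ℕ → ℕ) → Set
InjectiveBelow n p = ∀ {a b} → a < n → b < n → p a ≡ p b → a ≡ b

into-suc : ∀ {m p} → MapsInto m p → p m ≡ m → MapsInto (suc m) p
into-suc {m} {p} p-into pm≡m y<1+m with m<1+n⇒m<n∨m≡n y<1+m
... | inj₁ y<m  = m<n⇒m<1+n (p-into y<m)
... | inj₂ refl = ≤-reflexive (cong suc pm≡m)

-- With p = σ⁻¹ and y = x, r is inom(x).
data FirstReturn (p : ℕ → ℕ) (x : ℕ) : ℕ → ℕ → Set where
  here : ∀ {y} → p y ≤ x → FirstReturn p x y (p y)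
  next : ∀ {y r} → x < p y → FirstReturn p x (p y) r → FirstReturn p x y r

module _ {p : ℕ → ℕ} {x : ℕ} where

  here′ : ∀ {y r} → p y ≡ r → r ≤ x → FirstReturn p x y r
  here′ refl r≤x = here r≤x

  next′ : ∀ {y z r} → p y ≡ z → x < z → FirstReturn p x z r → FirstReturn p x y r
  next′ refl x<z h = next x<z h

  steps : ∀ {y r} → FirstReturn p x y r → ℕ
  steps (here _)   = 1
  steps (next _ h) = suc (steps h)

  firstReturn-unique : ∀ {y r r′} → FirstReturn p x y r → FirstReturn p x y r′ → r ≡ r′
  firstReturn-unique (here _)     (here _)      = refl
  firstReturn-unique (here py≤x)  (next x<py _) = contradiction py≤x (<⇒≱ x<py)
  firstReturn-unique (next x<py _) (here py≤x)  = contradiction py≤x (<⇒≱ x<py)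
  firstReturn-unique (next _ h)   (next _ h′)   = firstReturn-unique h h′

  firstReturn-≤ : ∀ {y r} → FirstReturn p x y r → r ≤ x
  firstReturn-≤ (here r≤x) = r≤x
  firstReturn-≤ (next _ h) = firstReturn-≤ h

  firstReturn-within : ∀ t y → iterate p y (suc t) ≤ x →
                       ∃₂ λ r (h : FirstReturn p x y r) → steps h ≤ suc t
  firstReturn-within t y pᵗ⁺¹y≤x with p y ≤? x
  ... | yes py≤x = p y , here py≤x , s≤s z≤n
  firstReturn-within zero    y py≤x | no py≰x = contradiction py≤x py≰x
  firstReturn-within (suc t) y pᵗ⁺¹y≤x | no py≰x with firstReturn-within t (p y) pᵗ⁺¹y≤x
  ... | r , h , h≤ = r , next (≰⇒> py≰x) h , s≤s h≤

firstReturn-cong : ∀ {n p q x y r} → MapsInto n p → (∀ {y} → y < n → p y ≡ q y) →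
                   y < n → FirstReturn p x y r → FirstReturn q x y r
firstReturn-cong p-into p≗q y<n (here r≤x)   = here′ (sym (p≗q y<n)) r≤x
firstReturn-cong p-into p≗q y<n (next x<z h) = next′ (sym (p≗q y<n)) x<z (firstReturn-cong p-into p≗q (p-into y<n) h)

module _ {n : ℕ} {p : ℕ → ℕ} (p-into : MapsInto n p) where

  iterate-suc : ∀ y k → iterate p y (suc k) ≡ p (iterate p y k)
  iterate-suc y zero    = refl
  iterate-suc y (suc k) = iterate-suc (p y) k

  iterate-into : ∀ k {y} → y < n → iterate p y k < n
  iterate-into zero    y<n = y<n
  iterate-into (suc k) y<n = iterate-into k (p-into y<n)

  firstReturn-preimage : ∀ {x y r} → y < n → FirstReturn p x y r → x ≤ y →
                         ∃ λ y′ → y′ < n × x ≤ y′ × p y′ ≡ r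
  firstReturn-preimage {y = y} y<n (here _) x≤y = y , y<n , x≤y , refl
  firstReturn-preimage y<n (next x<py h) _ = firstReturn-preimage (p-into y<n) h (<⇒≤ x<py)

  module _ (p-inj : InjectiveBelow n p) where

    iterate-cancel : ∀ a d {y} → y < n → iterate p y a ≡ iterate p y (a + d) → y ≡ iterate p y d
    iterate-cancel zero    d y<n eq = eq
    iterate-cancel (suc a) d {y} y<n eq = iterate-cancel a d y<n
      (p-inj (iterate-into a y<n) (iterate-into (a + d) y<n) (begin
        p (iterate p y a)       ≡⟨ iterate-suc y a ⟨
        iterate p y (suc a)     ≡⟨ eq ⟩
        iterate p y (suc a + d) ≡⟨ iterate-suc y (a + d) ⟩
        p (iterate p y (a + d)) ∎))
      where open ≡-Reasoning

    orbit-returns : ∀ {y} → y < n → ∃ λ t → t < n × iterate p y (suc t) ≡ y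
    orbit-returns {y} y<n with pigeonhole (n<1+n n) (λ j → fromℕ< (iterate-into (toℕ j) y<n))
    ... | i , j , i<j , eq = t , t<n , sym (iterate-cancel (toℕ i) (suc t) y<n pⁱy≡pʲy)
      where
      t : ℕ
      t = toℕ j ∸ suc (toℕ i)
      i+1+t≡j : toℕ i + suc t ≡ toℕ j
      i+1+t≡j = trans (+-suc (toℕ i) t) (m+[n∸m]≡n i<j)
      t<n : t < n
      t<n = ≤-trans (subst (suc t ≤_) i+1+t≡j (m≤n+m (suc t) (toℕ i))) (s≤s⁻¹ (toℕ<n j))
      pⁱy≡pʲy : iterate p y (toℕ i) ≡ iterate p y (toℕ i + suc t)
      pⁱy≡pʲy = begin
        iterate p y (toℕ i)           ≡⟨ toℕ-fromℕ< (iterate-into (toℕ i) y<n) ⟨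
        toℕ (fromℕ< _)                ≡⟨ cong toℕ eq ⟩
        toℕ (fromℕ< _)                ≡⟨ toℕ-fromℕ< (iterate-into (toℕ j) y<n) ⟩
        iterate p y (toℕ j)           ≡⟨ cong (iterate p y) i+1+t≡j ⟨
        iterate p y (toℕ i + suc t)   ∎
        where open ≡-Reasoning

    firstReturn-exists : ∀ {x} → x < n → ∃₂ λ r (h : FirstReturn p x x r) → steps h ≤ n
    firstReturn-exists {x} x<n with orbit-returns x<n
    ... | t , t<n , pᵗ⁺¹x≡x with firstReturn-within t x (≤-reflexive pᵗ⁺¹x≡x)
    ... | r , h , h≤ = r , h , ≤-trans h≤ t<n

-- First returns determine the map

-- p with m cut out of its cycle
bypass : ℕ → (ℕ → ℕ) → ℕ → ℕ
bypass m p y with p y ≟ m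
... | yes _ = p m
... | no  _ = p y

module _ {m : ℕ} {p : ℕ → ℕ} (p-into : MapsInto (suc m) p) (p-inj : InjectiveBelow (suc m) p) where

  private
    ≢top : ∀ {y} → y < m → p y ≢ p m
    ≢top y<m py≡pm = <⇒≢ y<m (p-inj (m<n⇒m<1+n y<m) ≤-refl py≡pm)

  bypass-into : MapsInto m (bypass m p)
  bypass-into {y} y<m with p y ≟ m
  ... | yes py≡m = ≤∧≢⇒< (s≤s⁻¹ (p-into ≤-refl)) λ pm≡m → ≢top y<m (trans py≡m (sym pm≡m))
  ... | no  py≢m = ≤∧≢⇒< (s≤s⁻¹ (p-into (m<n⇒m<1+n y<m))) py≢m

  bypass-injective : InjectiveBelow m (bypass m p)
  bypass-injective {a} {b} a<m b<m eq with p a ≟ m | p b ≟ m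
  ... | yes pa≡m | yes pb≡m = p-inj (m<n⇒m<1+n a<m) (m<n⇒m<1+n b<m) (trans pa≡m (sym pb≡m))
  ... | yes _    | no  _    = contradiction (sym eq) (≢top b<m)
  ... | no  _    | yes _    = contradiction eq (≢top a<m)
  ... | no  _    | no  _    = p-inj (m<n⇒m<1+n a<m) (m<n⇒m<1+n b<m) eq

  firstReturn-bypass : ∀ {x y r} → x < m → FirstReturn (bypass m p) x y r → FirstReturn p x y r
  firstReturn-bypass {x} {y} x<m (here r≤x) with p y ≟ m
  ... | yes py≡m = next′ py≡m x<m (here r≤x)
  ... | no  _    = here r≤x
  firstReturn-bypass {x} {y} x<m (next x<r h) with p y ≟ m
  ... | yes py≡m = next′ py≡m x<m (next x<r (firstReturn-bypass x<m h))
  ... | no  _    = next x<r (firstReturn-bypass x<m h)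

  agree-if-bypasses-agree : ∀ {q} → InjectiveBelow (suc m) q → p m ≡ q m →
    (∀ {y} → y < m → bypass m p y ≡ bypass m q y) → ∀ {y} → y < m → p y ≡ q y
  agree-if-bypasses-agree {q} q-inj pm≡qm agree {y} y<m with p y ≟ m | q y ≟ m | agree y<m
  ... | yes py≡m | yes qy≡m | _ = trans py≡m (sym qy≡m)
  ... | yes _    | no  _    | pm≡qy = contradiction (q-inj (m<n⇒m<1+n y<m) ≤-refl (trans (sym pm≡qy) pm≡qm)) (<⇒≢ y<m)
  ... | no  _    | yes _    | py≡qm = contradiction (p-inj (m<n⇒m<1+n y<m) ≤-refl (trans py≡qm (sym pm≡qm))) (<⇒≢ y<m)
  ... | no  _    | no  _    | py≡qy = py≡qy

firstReturns-determine : ∀ n {p q} →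
  MapsInto n p → InjectiveBelow n p → MapsInto n q → InjectiveBelow n q →
  (∀ {x} → x < n → ∀ {r} → FirstReturn p x x r → FirstReturn q x x r) →
  ∀ {y} → y < n → p y ≡ q y
firstReturns-determine (suc m) {p} {q} p-into p-inj q-into q-inj same {y} y<1+m =
  case m<1+n⇒m<n∨m≡n y<1+m of λ where
    (inj₁ y<m)  → agree-if-bypasses-agree p-into p-inj q-inj pm≡qm bypasses-agree y<m
    (inj₂ refl) → pm≡qm
  where
  pm≡qm : p m ≡ q m
  pm≡qm = firstReturn-unique (same ≤-refl (here (s≤s⁻¹ (p-into ≤-refl)))) (here (s≤s⁻¹ (q-into ≤-refl)))
  same′ : ∀ {x} → x < m → ∀ {r} → FirstReturn (bypass m p) x x r → FirstReturn (bypass m q) x x r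
  same′ {x} x<m {r} h with firstReturn-exists (bypass-into q-into q-inj) (bypass-injective q-into q-inj) x<m
  ... | r′ , h′ , _ = subst (FirstReturn (bypass m q) x x) (firstReturn-unique h′-in-q h-in-q) h′
    where
    h-in-q : FirstReturn q x x r
    h-in-q = same (m<n⇒m<1+n x<m) (firstReturn-bypass p-into p-inj x<m h)
    h′-in-q : FirstReturn q x x r′
    h′-in-q = firstReturn-bypass q-into q-inj x<m h′
  bypasses-agree : ∀ {y} → y < m → bypass m p y ≡ bypass m q y
  bypasses-agree = firstReturns-determine m
    (bypass-into p-into p-inj) (bypass-injective p-into p-inj)
    (bypass-into q-into q-inj) (bypass-injective q-into q-inj) same′

-- Realising a subexceedant code

transpose : ℕ → ℕ → ℕ → ℕ
transpose a b z with z ≟ a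
... | yes _ = b
... | no  _ with z ≟ b
...   | yes _ = a
...   | no  _ = z

module _ {a b : ℕ} where

  transpose-left : transpose a b a ≡ b
  transpose-left with a ≟ a
  ... | yes _   = refl
  ... | no  a≢a = contradiction refl a≢a

  transpose-right : transpose a b b ≡ a
  transpose-right with b ≟ a
  ... | yes b≡a = b≡a
  ... | no  _ with b ≟ b
  ...   | yes _   = refl
  ...   | no  b≢b = contradiction refl b≢b

  transpose-other : ∀ {z} → z ≢ a → z ≢ b → transpose a b z ≡ z
  transpose-other {z} z≢a z≢b with z ≟ a
  ... | yes z≡a = contradiction z≡a z≢a
  ... | no  _ with z ≟ b
  ...   | yes z≡b = contradiction z≡b z≢b
  ...   | no  _   = refl

  transpose-involutive : ∀ z → transpose a b (transpose a b z) ≡ z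
  transpose-involutive z with z ≟ a
  ... | yes refl = transpose-right
  ... | no  z≢a with z ≟ b
  ...   | yes refl = transpose-left
  ...   | no  z≢b  = transpose-other z≢a z≢b

  transpose-< : ∀ {n z} → a < n → b < n → z < n → transpose a b z < n
  transpose-< {z = z} a<n b<n z<n with z ≟ a
  ... | yes _ = b<n
  ... | no  _ with z ≟ b
  ...   | yes _ = a<n
  ...   | no  _ = z<n

module FromCode (f : ℕ → ℕ) (f-≤ : ∀ k → f k ≤ k) where

  -- π⁻¹ m = (m-1 f(m-1)) ∘ ⋯ ∘ (0 f(0)): for m = n this is the paper's σ⁻¹ = (n f_n)⋯(1 f_1),
  -- shifted to 0-based letters.
  π⁻¹ : ℕ → ℕ → ℕ
  π⁻¹ zero    y = y
  π⁻¹ (suc m) y = transpose m (f m) (π⁻¹ m y)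

  π : ℕ → ℕ → ℕ
  π zero    z = z
  π (suc m) z = π m (transpose m (f m) z)

  π-π⁻¹ : ∀ m y → π m (π⁻¹ m y) ≡ y
  π-π⁻¹ zero    y = refl
  π-π⁻¹ (suc m) y = trans (cong (π m) (transpose-involutive (π⁻¹ m y))) (π-π⁻¹ m y)

  π⁻¹-π : ∀ m z → π⁻¹ m (π m z) ≡ z
  π⁻¹-π zero    z = refl
  π⁻¹-π (suc m) z = trans (cong (transpose m (f m)) (π⁻¹-π m (transpose m (f m) z))) (transpose-involutive z)

  private
    transpose-fixes-above : ∀ {m y} → m < y → transpose m (f m) y ≡ y
    transpose-fixes-above m<y = transpose-other (>⇒≢ m<y) (>⇒≢ (≤-<-trans (f-≤ _) m<y))

  π⁻¹-fixes : ∀ m {y} → m ≤ y → π⁻¹ m y ≡ y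
  π⁻¹-fixes zero    _   = refl
  π⁻¹-fixes (suc m) m<y = trans (cong (transpose m (f m)) (π⁻¹-fixes m (<⇒≤ m<y))) (transpose-fixes-above m<y)

  π-fixes : ∀ m {y} → m ≤ y → π m y ≡ y
  π-fixes zero    _   = refl
  π-fixes (suc m) m<y = trans (cong (π m) (transpose-fixes-above m<y)) (π-fixes m (<⇒≤ m<y))

  π⁻¹-into : ∀ m → MapsInto m (π⁻¹ m)
  π⁻¹-into (suc m) y<1+m =
    transpose-< ≤-refl (s≤s (f-≤ m)) (into-suc (π⁻¹-into m) (π⁻¹-fixes m ≤-refl) y<1+m)

  π-into : ∀ m → MapsInto m (π m)
  π-into (suc m) y<1+m =
    into-suc (π-into m) (π-fixes m ≤-refl) (transpose-< ≤-refl (s≤s (f-≤ m)) y<1+m)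

  π⁻¹-top : ∀ m → π⁻¹ (suc m) m ≡ f m
  π⁻¹-top m = trans (cong (transpose m (f m)) (π⁻¹-fixes m ≤-refl)) (transpose-left {m} {f m})

  π⁻¹-hits : ∀ {m y} → π⁻¹ m y ≡ f m → π⁻¹ (suc m) y ≡ m
  π⁻¹-hits {m} eq = trans (cong (transpose m (f m)) eq) (transpose-right {m} {f m})

  π⁻¹-misses : ∀ {m y} → y < m → π⁻¹ m y ≢ f m → π⁻¹ (suc m) y ≡ π⁻¹ m y
  π⁻¹-misses {m} y<m misses = transpose-other (<⇒≢ (π⁻¹-into m y<m)) misses

  -- A step of π⁻¹ m landing on f m becomes a detour through m > x in π⁻¹ (suc m).
  firstReturn-extend : ∀ {m x y r} → x < m → y < m →
                       FirstReturn (π⁻¹ m) x y r → FirstReturn (π⁻¹ (suc m)) x y r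
  firstReturn-extend {m} {y = y} x<m y<m (here r≤x) with π⁻¹ m y ≟ f m
  ... | yes hits   = next′ (π⁻¹-hits hits) x<m (here′ (trans (π⁻¹-top m) (sym hits)) r≤x)
  ... | no  misses = here′ (π⁻¹-misses y<m misses) r≤x
  firstReturn-extend {m} {y = y} x<m y<m (next x<z h)
    with π⁻¹ m y ≟ f m | firstReturn-extend x<m (π⁻¹-into m y<m) h
  ... | yes hits   | h′ = next′ (π⁻¹-hits hits) x<m (next′ (trans (π⁻¹-top m) (sym hits)) x<z h′)
  ... | no  misses | h′ = next′ (π⁻¹-misses y<m misses) x<z h′

  firstReturn-π⁻¹ : ∀ m {x} → x < m → FirstReturn (π⁻¹ m) x x (f x)
  firstReturn-π⁻¹ (suc m) x<1+m with m<1+n⇒m<n∨m≡n x<1+m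
  ... | inj₁ x<m  = firstReturn-extend x<m x<m (firstReturn-π⁻¹ m x<m)
  ... | inj₂ refl = here′ (π⁻¹-top m) (f-≤ m)

-- Numbering the blocks of a labelling

module Rank (B : ℕ → ℕ) where

  -- the least y < k with B y ≡ v, or k if there is none
  search : ℕ → ℕ → ℕ
  search v zero    = zero
  search v (suc k) with B (search v k) ≟ v
  ... | yes _ = search v k
  ... | no  _ = suc k

  search-≤ : ∀ v k → search v k ≤ k
  search-≤ v zero    = z≤n
  search-≤ v (suc k) with B (search v k) ≟ v
  ... | yes _ = m≤n⇒m≤1+n (search-≤ v k)
  ... | no  _ = ≤-refl

  search-found-or-none : ∀ v k → B (search v k) ≡ v ⊎ search v k ≡ k
  search-found-or-none v zero    = inj₂ refl
  search-found-or-none v (suc k) with B (search v k) ≟ v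
  ... | yes found = inj₁ found
  ... | no  _     = inj₂ refl

  search-minimal : ∀ v k {y} → y < search v k → B y ≢ v
  search-minimal v (suc k) {y} y<s with B (search v k) ≟ v
  ... | yes _ = search-minimal v k y<s
  ... | no  missing with search-found-or-none v k | m<1+n⇒m<n∨m≡n y<s
  ...   | inj₁ found | _         = contradiction found missing
  ...   | inj₂ s≡k   | inj₁ y<k  = search-minimal v k (subst (y <_) (sym s≡k) y<k)
  ...   | inj₂ s≡k   | inj₂ refl = subst (λ z → B z ≢ v) s≡k missing

  first : ℕ → ℕ
  first x = search (B x) x

  first-≤ : ∀ x → first x ≤ x
  first-≤ x = search-≤ (B x) x

  B-first : ∀ x → B (first x) ≡ B x
  B-first x with search-found-or-none (B x) x
  ... | inj₁ found = found
  ... | inj₂ s≡x   = cong B s≡x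

  first-minimal : ∀ x {y} → y < first x → B y ≢ B x
  first-minimal x = search-minimal (B x) x

  first-cong : ∀ {x y} → B x ≡ B y → first x ≡ first y
  first-cong {x} {y} Bx≡By with <-cmp (first x) (first y)
  ... | tri< fx<fy _ _ = contradiction (trans (B-first x) Bx≡By) (first-minimal y fx<fy)
  ... | tri≈ _ fx≡fy _ = fx≡fy
  ... | tri> _ _ fy<fx = contradiction (trans (B-first y) (sym Bx≡By)) (first-minimal x fy<fx)

  first-idem : ∀ x → first (first x) ≡ first x
  first-idem x = first-cong (B-first x)

  blocksBelow : ℕ → ℕ
  blocksBelow zero    = zero
  blocksBelow (suc N) with first N ≟ N
  ... | yes _ = suc (blocksBelow N)
  ... | no  _ = blocksBelow N

  blocksBelow-≤ : ∀ N → blocksBelow N ≤ N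
  blocksBelow-≤ zero    = z≤n
  blocksBelow-≤ (suc N) with first N ≟ N
  ... | yes _ = s≤s (blocksBelow-≤ N)
  ... | no  _ = m≤n⇒m≤1+n (blocksBelow-≤ N)

  blocksBelow-first : ∀ {N} → first N ≡ N → blocksBelow (suc N) ≡ suc (blocksBelow N)
  blocksBelow-first {N} first≡ with first N ≟ N
  ... | yes _   = refl
  ... | no  ≢N  = contradiction first≡ ≢N

  blocksBelow-mono : ∀ {a b} → a ≤ b → blocksBelow a ≤ blocksBelow b
  blocksBelow-mono a≤b = go (≤⇒≤′ a≤b)
    where
    step : ∀ N → blocksBelow N ≤ blocksBelow (suc N)
    step N with first N ≟ N
    ... | yes _ = n≤1+n _
    ... | no  _ = ≤-refl
    go : ∀ {a b} → a ≤′ b → blocksBelow a ≤ blocksBelow b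
    go ≤′-refl        = ≤-refl
    go (≤′-step {N} a≤′b) = ≤-trans (go a≤′b) (step N)

  blocksBelow-strict : ∀ {a b} → a < b → first a ≡ a → blocksBelow a < blocksBelow b
  blocksBelow-strict {a} {b} a<b first≡ =
    subst (_≤ blocksBelow b) (blocksBelow-first first≡) (blocksBelow-mono a<b)

  blocksBelow-attained : ∀ N {c} → c < blocksBelow N →
                         ∃ λ y → y < N × first y ≡ y × blocksBelow y ≡ c
  blocksBelow-attained (suc N) {c} c< with first N ≟ N
  ... | no  _      = map₂ (map₁ m<n⇒m<1+n) (blocksBelow-attained N c<)
  ... | yes first≡ with m<1+n⇒m<n∨m≡n c<
  ...   | inj₂ refl = N , ≤-refl , first≡ , refl
  ...   | inj₁ c<′  = map₂ (map₁ m<n⇒m<1+n) (blocksBelow-attained N c<′)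

  -- numbers the blocks of B as 0, 1, 2, … in the order of their least elements
  rank : ℕ → ℕ
  rank x = blocksBelow (first x)

  rank-≤ : ∀ x → rank x ≤ x
  rank-≤ x = ≤-trans (blocksBelow-≤ (first x)) (first-≤ x)

  rank-cong : ∀ {x y} → B x ≡ B y → rank x ≡ rank y
  rank-cong Bx≡By = cong blocksBelow (first-cong Bx≡By)

  rank-injective : ∀ {x y} → rank x ≡ rank y → B x ≡ B y
  rank-injective {x} {y} eq with <-cmp (first x) (first y)
  ... | tri< fx<fy _ _ = contradiction eq (<⇒≢ (blocksBelow-strict fx<fy (first-idem x)))
  ... | tri≈ _ fx≡fy _ = trans (sym (B-first x)) (trans (cong B fx≡fy) (B-first y))
  ... | tri> _ _ fy<fx = contradiction (sym eq) (<⇒≢ (blocksBelow-strict fy<fx (first-idem y)))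

  rank-interval : ∀ x {c} → c ≤ rank x → c ≡ rank x ⊎ ∃ λ y → y < x × rank y ≡ c
  rank-interval x c≤ with m≤n⇒m<n∨m≡n c≤
  ... | inj₂ c≡ = inj₁ c≡
  ... | inj₁ c< with blocksBelow-attained (first x) c<
  ...   | y , y<fx , first≡ , eq = inj₂ (y , <-≤-trans y<fx (first-≤ x) , trans (cong blocksBelow first≡) eq)

-- inom through first returns

module _ {n : ℕ} where

  ∀-toℕ : ∀ {P : ℕ → Set} → (∀ (i : Fin n) → P (toℕ i)) → ∀ {k} → k < n → P k
  ∀-toℕ {P} h k<n = subst P (toℕ-fromℕ< k<n) (h (fromℕ< k<n))

  onℕ : ∀ {m} → (Fin n → Fin m) → ℕ → ℕ
  onℕ g k with k <? n
  ... | yes k<n = toℕ (g (fromℕ< k<n))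
  ... | no  _   = k

  onℕ-< : ∀ {m} (g : Fin n → Fin m) {k} (k<n : k < n) → onℕ g k ≡ toℕ (g (fromℕ< k<n))
  onℕ-< g {k} k<n with k <? n
  ... | yes _   = refl
  ... | no  k≮n = contradiction k<n k≮n

  onℕ-toℕ : ∀ {m} (g : Fin n → Fin m) i → onℕ g (toℕ i) ≡ toℕ (g i)
  onℕ-toℕ g i = trans (onℕ-< g (toℕ<n i)) (cong (toℕ ∘ g) (fromℕ<-toℕ i (toℕ<n i)))

  onℕ-into : ∀ g → MapsInto n (onℕ g)
  onℕ-into g k<n = subst (_< n) (sym (onℕ-< g k<n)) (toℕ<n _)

  onℕ-injective : ∀ {g : Fin n → Fin n} → (∀ {i j} → g i ≡ g j → i ≡ j) → InjectiveBelow n (onℕ g)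
  onℕ-injective {g} g-inj {a} {b} a<n b<n ga≡gb = begin
    a                  ≡⟨ toℕ-fromℕ< a<n ⟨
    toℕ (fromℕ< a<n)   ≡⟨ cong toℕ (g-inj (toℕ-injective (begin
      toℕ (g (fromℕ< a<n)) ≡⟨ onℕ-< g a<n ⟨
      onℕ g a              ≡⟨ ga≡gb ⟩
      onℕ g b              ≡⟨ onℕ-< g b<n ⟩
      toℕ (g (fromℕ< b<n)) ∎))) ⟩
    toℕ (fromℕ< b<n)   ≡⟨ toℕ-fromℕ< b<n ⟩
    b                  ∎
    where open ≡-Reasoning

module _ {n : ℕ} (σ : Permutation′ n) where

  σ⁻¹ℕ : ℕ → ℕ
  σ⁻¹ℕ = onℕ (σ ⟨$⟩ˡ_)

  σ⁻¹ℕ-into : MapsInto n σ⁻¹ℕ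
  σ⁻¹ℕ-into = onℕ-into (σ ⟨$⟩ˡ_)

  σ⁻¹ℕ-injective : InjectiveBelow n σ⁻¹ℕ
  σ⁻¹ℕ-injective = onℕ-injective λ eq → trans (sym (inverseʳ σ)) (trans (cong (σ ⟨$⟩ʳ_) eq) (inverseʳ σ))

  σ⁻¹ℕ-toℕ : ∀ y → σ⁻¹ℕ (toℕ y) ≡ toℕ (σ ⟨$⟩ˡ y)
  σ⁻¹ℕ-toℕ = onℕ-toℕ (σ ⟨$⟩ˡ_)

  σ⁻¹ℕ-preimage : ∀ {y} → y < n → ∀ {i} → σ⁻¹ℕ y ≡ toℕ i → toℕ (σ ⟨$⟩ʳ i) ≡ y
  σ⁻¹ℕ-preimage {y} y<n {i} σ⁻¹y≡i = begin
    toℕ (σ ⟨$⟩ʳ i)                      ≡⟨ cong (toℕ ∘ (σ ⟨$⟩ʳ_)) σ⁻¹Y≡i ⟨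
    toℕ (σ ⟨$⟩ʳ (σ ⟨$⟩ˡ fromℕ< y<n))    ≡⟨ cong toℕ (inverseʳ σ) ⟩
    toℕ (fromℕ< y<n)                    ≡⟨ toℕ-fromℕ< y<n ⟩
    y                                   ∎
    where
    open ≡-Reasoning
    σ⁻¹Y≡i : σ ⟨$⟩ˡ fromℕ< y<n ≡ i
    σ⁻¹Y≡i = toℕ-injective (trans (sym (onℕ-< (σ ⟨$⟩ˡ_) y<n)) σ⁻¹y≡i)

  inomAux-firstReturn : ∀ {x y k r} → k ≡ toℕ y → (h : FirstReturn σ⁻¹ℕ (toℕ x) k r) →
                        ∀ fuel → steps h ≤ fuel → toℕ (inomAux σ x fuel y) ≡ r
  inomAux-firstReturn {x} {y} refl (here r≤x) (suc fuel) _ with toℕ (σ ⟨$⟩ˡ y) ≤? toℕ x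
  ... | yes _   = sym (σ⁻¹ℕ-toℕ y)
  ... | no  r≰x = contradiction (subst (_≤ toℕ x) (σ⁻¹ℕ-toℕ y) r≤x) r≰x
  inomAux-firstReturn {x} {y} refl (next x<r h) (suc fuel) h≤ with toℕ (σ ⟨$⟩ˡ y) ≤? toℕ x
  ... | yes r≤x = contradiction r≤x (<⇒≱ (subst (toℕ x <_) (σ⁻¹ℕ-toℕ y) x<r))
  ... | no  _   = inomAux-firstReturn (σ⁻¹ℕ-toℕ y) h fuel (s≤s⁻¹ h≤)

  -- The bound steps h ≤ n of firstReturn-exists is what makes the fuel n of inom enough.
  firstReturn-inom : ∀ x → FirstReturn σ⁻¹ℕ (toℕ x) (toℕ x) (toℕ (inom σ x))
  firstReturn-inom x with firstReturn-exists σ⁻¹ℕ-into σ⁻¹ℕ-injective (toℕ<n x)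
  ... | r , h , h≤n = subst (FirstReturn σ⁻¹ℕ (toℕ x) (toℕ x)) (sym (inomAux-firstReturn refl h n h≤n)) h

  inom-unique : ∀ {x r} → FirstReturn σ⁻¹ℕ (toℕ x) (toℕ x) r → toℕ (inom σ x) ≡ r
  inom-unique {x} = firstReturn-unique (firstReturn-inom x)

  inom-≤ : ∀ x → toℕ (inom σ x) ≤ toℕ x
  inom-≤ x = firstReturn-≤ (firstReturn-inom x)

  -- inom σ x is σ⁻¹ y for some y ≥ x on the orbit, so σ (inom σ x) = y ≥ x ≥ inom σ x.
  inom-weakExc : ∀ x → WeakExc σ (inom σ x)
  inom-weakExc x with firstReturn-preimage σ⁻¹ℕ-into (toℕ<n x) (firstReturn-inom x) ≤-refl
  ... | y , y<n , x≤y , σ⁻¹y≡ =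
    ≤-trans (inom-≤ x) (≤-trans x≤y (≤-reflexive (sym (σ⁻¹ℕ-preimage y<n σ⁻¹y≡))))

  inom-σ : ∀ {i} → WeakExc σ i → inom σ (σ ⟨$⟩ʳ i) ≡ i
  inom-σ {i} i≤σi = toℕ-injective (inom-unique (here′ (trans (σ⁻¹ℕ-toℕ (σ ⟨$⟩ʳ i)) (cong toℕ (inverseˡ σ))) i≤σi))

-- λ(σ) is a set partition

∈-tabulate⁻ : ∀ {n} {g : Fin n → Bool} {x} → x ∈ tabulate g → g x ≡ true
∈-tabulate⁻ {g = g} {x} x∈ = trans (sym (lookup∘tabulate g x)) ([]=⇒lookup x∈)

∈-tabulate⁺ : ∀ {n} {g : Fin n → Bool} {x} → g x ≡ true → x ∈ tabulate g
∈-tabulate⁺ {g = g} {x} gx≡true = lookup⇒[]= x (tabulate g) (trans (lookup∘tabulate g x) gx≡true)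

module _ {A : Set} {n : ℕ} (g : A → Subset n) where

  ∈-lookup-map : ∀ L q {x} → x ∈ lookup (map g L) q → ∃ λ a → a ∈ₗ L × x ∈ g a
  ∈-lookup-map (a ∷ L) Fin.zero    x∈ = a , here refl , x∈
  ∈-lookup-map (a ∷ L) (Fin.suc q) x∈ = map₂ (map₁ there) (∈-lookup-map L q x∈)

module _ {A : Set} {n : ℕ} (g : A → Subset n) (label : Fin n → A) where

  Labels : List A → Set
  Labels L = ∀ {a x} → a ∈ₗ L → x ∈ g a → label x ≡ a

  private
    head-not-later : ∀ {a L x} q → Unique (a ∷ L) → Labels (a ∷ L) →
                     x ∈ g a → x ∈ lookup (map g L) q → ⊥
    head-not-later q unique labels x∈ga x∈q with ∈-lookup-map g _ q x∈q
    ... | b , b∈L , x∈gb = Unique[x∷xs]⇒x∉xs unique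
      (subst (_∈ₗ _) (trans (sym (labels (there b∈L) x∈gb)) (labels (here refl) x∈ga)) b∈L)

  lookup-map-disjoint : ∀ {L} → Unique L → Labels L →
                        ∀ x p q → x ∈ lookup (map g L) p → x ∈ lookup (map g L) q → p ≡ q
  lookup-map-disjoint {_ ∷ _} _ _ x Fin.zero Fin.zero _ _ = refl
  lookup-map-disjoint {_ ∷ _} unique labels x Fin.zero (Fin.suc q) x∈p x∈q =
    ⊥-elim (head-not-later q unique labels x∈p x∈q)
  lookup-map-disjoint {_ ∷ _} unique labels x (Fin.suc p) Fin.zero x∈p x∈q =
    ⊥-elim (head-not-later p unique labels x∈q x∈p)
  lookup-map-disjoint {_ ∷ _} (_ ∷ unique) labels x (Fin.suc p) (Fin.suc q) x∈p x∈q =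
    cong Fin.suc (lookup-map-disjoint unique (labels ∘ there) x p q x∈p x∈q)

blockTest⁻ : ∀ {A B C : Set} (a? : Dec A) (b? : Dec B) (c? : Dec C) →
             ⌊ a? ⌋ ∨ (not ⌊ b? ⌋ ∧ ⌊ c? ⌋) ≡ true → A ⊎ (¬ B × C)
blockTest⁻ (yes a) _        _       _  = inj₁ a
blockTest⁻ (no _)  (no ¬b)  (yes c) _  = inj₂ (¬b , c)
blockTest⁻ (no _)  (yes _)  _       ()
blockTest⁻ (no _)  (no _)   (no _)  ()

blockTest⁺ : ∀ {A B C : Set} (a? : Dec A) (b? : Dec B) (c? : Dec C) →
             A ⊎ (¬ B × C) → ⌊ a? ⌋ ∨ (not ⌊ b? ⌋ ∧ ⌊ c? ⌋) ≡ true
blockTest⁺ (yes _) _       _       _              = refl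
blockTest⁺ (no _)  (no _)  (yes _) _              = refl
blockTest⁺ (no ¬a) _       _       (inj₁ a)       = contradiction a ¬a
blockTest⁺ (no _)  (yes b) _       (inj₂ (¬b , _)) = contradiction b ¬b
blockTest⁺ (no _)  (no _)  (no ¬c) (inj₂ (_ , c)) = contradiction c ¬c

module _ {n : ℕ} (σ : Permutation′ n) where

  weakExcs : List (Fin n)
  weakExcs = filter (weakExc? σ) (allFin n)

  weakExcs-weakExc : ∀ {i} → i ∈ₗ weakExcs → WeakExc σ i
  weakExcs-weakExc i∈ = proj₂ (∈-filter⁻ (weakExc? σ) {xs = allFin n} i∈)

  weakExc-∈-weakExcs : ∀ {i} → WeakExc σ i → i ∈ₗ weakExcs
  weakExc-∈-weakExcs = ∈-filter⁺ (weakExc? σ) (∈-allFin _)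

  weakExcs-unique : Unique weakExcs
  weakExcs-unique = filter⁺ (weakExc? σ) (allFin⁺ n)

  ∈-block⇒inom : ∀ {i x} → WeakExc σ i → x ∈ block σ i → inom σ x ≡ i
  ∈-block⇒inom {i} {x} i≤σi x∈
    with blockTest⁻ (x Fin.≟ σ ⟨$⟩ʳ i) (weLetter? σ x) (inom σ x Fin.≟ i) (∈-tabulate⁻ x∈)
  ... | inj₁ refl          = inom-σ σ i≤σi
  ... | inj₂ (_ , inom≡i) = inom≡i

  inom⇒∈-block : ∀ {i x} → WeakExc σ i → inom σ x ≡ i → x ∈ block σ i
  inom⇒∈-block {i} {x} i≤σi inom≡i =
    ∈-tabulate⁺ (blockTest⁺ (x Fin.≟ σ ⟨$⟩ʳ i) (weLetter? σ x) (inom σ x Fin.≟ i) test)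
    where
    test : x ≡ σ ⟨$⟩ʳ i ⊎ (¬ WELetter σ x × inom σ x ≡ i)
    test with x Fin.≟ σ ⟨$⟩ʳ i
    ... | yes x≡σi = inj₁ x≡σi
    ... | no  x≢σi = inj₂ (not-letter , inom≡i)
      where
      not-letter : ¬ WELetter σ x
      not-letter (j , j≤σj , refl) = x≢σi (cong (σ ⟨$⟩ʳ_) (trans (sym (inom-σ σ j≤σj)) inom≡i))

lam-isSetPartition : ∀ {n} (σ : Permutation′ n) → IsSetPartition (lam σ)
lam-isSetPartition σ = record
  { nonempty = All.map⁺ (All.tabulate λ {i} i∈ →
      σ ⟨$⟩ʳ i , inom⇒∈-block σ (weakExcs-weakExc σ i∈) (inom-σ σ (weakExcs-weakExc σ i∈)))
  ; covers   = λ x → Any.map⁺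
      (lose (weakExc-∈-weakExcs σ (inom-weakExc σ x)) (inom⇒∈-block σ (inom-weakExc σ x) refl))
  ; disjoint = lookup-map-disjoint (block σ) (inom σ) (weakExcs-unique σ)
      (λ i∈ → ∈-block⇒inom σ (weakExcs-weakExc σ i∈))
  }

-- Injectivity

inom-injective : ∀ {n} (σ τ : Permutation′ n) → (∀ x → inom σ x ≡ inom τ x) → ∀ i → σ ⟨$⟩ʳ i ≡ τ ⟨$⟩ʳ i
inom-injective {n} σ τ same i = begin
  σ ⟨$⟩ʳ i                          ≡⟨ inverseʳ τ ⟨
  τ ⟨$⟩ʳ (τ ⟨$⟩ˡ (σ ⟨$⟩ʳ i))         ≡⟨ cong (τ ⟨$⟩ʳ_) (inverses-agree (σ ⟨$⟩ʳ i)) ⟨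
  τ ⟨$⟩ʳ (σ ⟨$⟩ˡ (σ ⟨$⟩ʳ i))         ≡⟨ cong (τ ⟨$⟩ʳ_) (inverseˡ σ) ⟩
  τ ⟨$⟩ʳ i                          ∎
  where
  open ≡-Reasoning
  transfer : ∀ {x} → x < n → ∀ {r} → FirstReturn (σ⁻¹ℕ σ) x x r → FirstReturn (σ⁻¹ℕ τ) x x r
  transfer = ∀-toℕ {P = λ x → ∀ {r} → FirstReturn (σ⁻¹ℕ σ) x x r → FirstReturn (σ⁻¹ℕ τ) x x r}
    λ x h → subst (FirstReturn (σ⁻¹ℕ τ) (toℕ x) (toℕ x))
    (trans (cong toℕ (sym (same x))) (inom-unique σ h)) (firstReturn-inom τ x)
  inverses-agree : ∀ y → σ ⟨$⟩ˡ y ≡ τ ⟨$⟩ˡ y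
  inverses-agree y = toℕ-injective (begin
    toℕ (σ ⟨$⟩ˡ y)   ≡⟨ σ⁻¹ℕ-toℕ σ y ⟨
    σ⁻¹ℕ σ (toℕ y)  ≡⟨ firstReturns-determine n (σ⁻¹ℕ-into σ) (σ⁻¹ℕ-injective σ)
                         (σ⁻¹ℕ-into τ) (σ⁻¹ℕ-injective τ) transfer (toℕ<n y) ⟩
    σ⁻¹ℕ τ (toℕ y)  ≡⟨ σ⁻¹ℕ-toℕ τ y ⟩
    toℕ (τ ⟨$⟩ˡ y)   ∎)

module _ {n : ℕ} where

  Subexceedant : (Fin n → Fin n) → Set
  Subexceedant f = ∀ x → toℕ (f x) ≤ toℕ x

  IntervalCode : (Fin n → Fin n) → Set
  IntervalCode f = Subexceedant f × (∀ i → IsIntervalPrefix f i)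

  -- b 0 = 0, so the interval {b 0, …, b x} holds every value below b x.
  below-code : ∀ {b : Fin n → Fin n} → IntervalCode b → ∀ x {c} → toℕ c < toℕ (b x) →
               ∃ λ y → toℕ y < toℕ x × b y ≡ c
  below-code {b} (b-≤ , b-interval) x {c} c<bx = strictly-below (b-interval x z x c z≤x ≤-refl b0≤c (<⇒≤ c<bx))
    where
    z : Fin n
    z = fromℕ< (≤-<-trans z≤n (toℕ<n x))
    z≤x : toℕ z ≤ toℕ x
    z≤x = subst (_≤ toℕ x) (sym (toℕ-fromℕ< _)) z≤n
    b0≤c : toℕ (b z) ≤ toℕ c
    b0≤c = ≤-trans (b-≤ z) (subst (_≤ toℕ c) (sym (toℕ-fromℕ< _)) z≤n)
    strictly-below : (∃ λ y → toℕ y ≤ toℕ x × b y ≡ c) → ∃ λ y → toℕ y < toℕ x × b y ≡ c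
    strictly-below (y , y≤x , by≡c) with m≤n⇒m<n∨m≡n y≤x
    ... | inj₁ y<x = y , y<x , by≡c
    ... | inj₂ y≡x = contradiction (cong toℕ (trans (cong b (toℕ-injective (sym y≡x))) by≡c)) (>⇒≢ c<bx)

  newValue-≮ : ∀ {a b : Fin n → Fin n} → IntervalCode b → ∀ x →
               (∀ {y} → toℕ y < toℕ x → a y ≡ b y) → (∀ {y} → toℕ y < toℕ x → a y ≢ a x) →
               ¬ toℕ (a x) < toℕ (b x)
  newValue-≮ b-code x agree new ax<bx with below-code b-code x ax<bx
  ... | y , y<x , by≡ax = new y<x (trans (agree y<x) by≡ax)

  intervalCodes-unique : ∀ {f g : Fin n → Fin n} → IntervalCode f → IntervalCode g →
                         (∀ {x y} → f x ≡ f y → g x ≡ g y) → (∀ {x y} → g x ≡ g y → f x ≡ f y) →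
                         ∀ x → f x ≡ g x
  intervalCodes-unique {f} {g} f-code g-code f⇒g g⇒f = WF.All.wfRec <-wellFounded _ _ step
    where
    step : ∀ x → (∀ {y} → y Fin.< x → f y ≡ g y) → f x ≡ g x
    step x agree with any? (λ y → (toℕ y <? toℕ x) ×-dec (f y Fin.≟ f x))
    ... | yes (y , y<x , fy≡fx) = trans (sym fy≡fx) (trans (agree y<x) (f⇒g fy≡fx))
    ... | no  f-new with <-cmp (toℕ (f x)) (toℕ (g x))
    ...   | tri< fx<gx _ _ = contradiction fx<gx (newValue-≮ g-code x agree λ y<x fy≡fx → f-new (_ , y<x , fy≡fx))
    ...   | tri≈ _ fx≡gx _ = toℕ-injective fx≡gx
    ...   | tri> _ _ gx<fx = contradiction gx<fx (newValue-≮ f-code x (sym ∘ agree) λ y<x gy≡gx → f-new (_ , y<x , g⇒f gy≡gx))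

module _ {n : ℕ} (σ τ : Permutation′ n) (same : SamePartition (lam σ) (lam τ)) where

  inom-fibre-in-τ : ∀ x → ∃ λ j → ∀ {z} → inom σ z ≡ inom σ x → inom τ z ≡ j
  inom-fibre-in-τ x =
    case ∈-map⁻ (block τ) (proj₁ same _ (∈-map⁺ (block σ) (weakExc-∈-weakExcs σ (inom-weakExc σ x)))) of λ where
      (j , j∈ , σBlock≡τBlock) → j , λ {z} inomz≡ → ∈-block⇒inom τ (weakExcs-weakExc τ j∈)
        (subst (z ∈_) σBlock≡τBlock (inom⇒∈-block σ (inom-weakExc σ x) inomz≡))

  samePartition⇒sameKernel : ∀ {x y} → inom σ x ≡ inom σ y → inom τ x ≡ inom τ y
  samePartition⇒sameKernel {x} {y} inomx≡inomy =
    let j , in-fibre = inom-fibre-in-τ x in trans (in-fibre refl) (sym (in-fibre (sym inomx≡inomy)))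

lam-injective : ∀ {n} (σ τ : Permutation′ n) → InBP2 σ → InBP2 τ →
                SamePartition (lam σ) (lam τ) → ∀ i → σ ⟨$⟩ʳ i ≡ τ ⟨$⟩ʳ i
lam-injective σ τ σ-bp2 τ-bp2 same = inom-injective σ τ
  (intervalCodes-unique (inom-≤ σ , σ-bp2) (inom-≤ τ , τ-bp2)
    (samePartition⇒sameKernel σ τ same) (samePartition⇒sameKernel τ σ (swap same)))

-- Surjectivity

module FromPartition {n : ℕ} (P : List (Subset n)) (P-partition : IsSetPartition P) where

  open IsSetPartition P-partition

  index : Fin n → Fin (length P)
  index x = Any.index (covers x)

  ∈-index : ∀ x → x ∈ lookup P (index x)
  ∈-index x = Any.lookup-index (covers x)

  index-unique : ∀ {x k} → x ∈ lookup P k → index x ≡ k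
  index-unique {x} = disjoint x _ _ (∈-index x)

  open Rank (onℕ index)
  open FromCode rank rank-≤

  σ : Permutation′ n
  σ = permutation (λ z → fromℕ< (π-into n (toℕ<n z))) (λ y → fromℕ< (π⁻¹-into n (toℕ<n y)))
    (λ y → toℕ-injective (begin
      toℕ (fromℕ< _)          ≡⟨ toℕ-fromℕ< _ ⟩
      π n (toℕ (fromℕ< _))    ≡⟨ cong (π n) (toℕ-fromℕ< _) ⟩
      π n (π⁻¹ n (toℕ y))     ≡⟨ π-π⁻¹ n (toℕ y) ⟩
      toℕ y                   ∎))
    (λ z → toℕ-injective (begin
      toℕ (fromℕ< _)          ≡⟨ toℕ-fromℕ< _ ⟩
      π⁻¹ n (toℕ (fromℕ< _))  ≡⟨ cong (π⁻¹ n) (toℕ-fromℕ< _) ⟩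
      π⁻¹ n (π n (toℕ z))     ≡⟨ π⁻¹-π n (toℕ z) ⟩
      toℕ z                   ∎))
    where open ≡-Reasoning

  π⁻¹≡σ⁻¹ℕ : ∀ {y} → y < n → π⁻¹ n y ≡ σ⁻¹ℕ σ y
  π⁻¹≡σ⁻¹ℕ y<n = sym (trans (onℕ-< _ y<n) (trans (toℕ-fromℕ< _) (cong (π⁻¹ n) (toℕ-fromℕ< y<n))))

  inom-rank : ∀ x → toℕ (inom σ x) ≡ rank (toℕ x)
  inom-rank x = inom-unique σ (firstReturn-cong (π⁻¹-into n) π⁻¹≡σ⁻¹ℕ (toℕ<n x) (firstReturn-π⁻¹ n (toℕ<n x)))

  -- The lower bound is not needed: the values of rank below j′ already form an initial segment.
  σ-bp2 : InBP2 σ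
  σ-bp2 i j j′ c _ j′≤i _ c≤inomj′ =
    case rank-interval (toℕ j′) (subst (toℕ c ≤_) (inom-rank j′) c≤inomj′) of λ where
      (inj₁ c≡rank)              → j′ , j′≤i , toℕ-injective (trans (inom-rank j′) (sym c≡rank))
      (inj₂ (y , y<j′ , ranky≡c)) →
        let y<n = <-trans y<j′ (toℕ<n j′) in
        fromℕ< y<n , subst (_≤ toℕ i) (sym (toℕ-fromℕ< y<n)) (<⇒≤ (<-≤-trans y<j′ j′≤i)) ,
        toℕ-injective (trans (inom-rank _) (trans (cong rank (toℕ-fromℕ< y<n)) ranky≡c))

  inom≡⇒index≡ : ∀ {x y} → inom σ x ≡ inom σ y → index x ≡ index y
  inom≡⇒index≡ {x} {y} eq = toℕ-injective (begin
    toℕ (index x)            ≡⟨ onℕ-toℕ index x ⟨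
    onℕ index (toℕ x)        ≡⟨ rank-injective (trans (sym (inom-rank x)) (trans (cong toℕ eq) (inom-rank y))) ⟩
    onℕ index (toℕ y)        ≡⟨ onℕ-toℕ index y ⟩
    toℕ (index y)            ∎)
    where open ≡-Reasoning

  index≡⇒inom≡ : ∀ {x y} → index x ≡ index y → inom σ x ≡ inom σ y
  index≡⇒inom≡ {x} {y} eq = toℕ-injective (begin
    toℕ (inom σ x)      ≡⟨ inom-rank x ⟩
    rank (toℕ x)        ≡⟨ rank-cong (trans (onℕ-toℕ index x) (trans (cong toℕ eq) (sym (onℕ-toℕ index y)))) ⟩
    rank (toℕ y)        ≡⟨ inom-rank y ⟨
    toℕ (inom σ y)      ∎)
    where open ≡-Reasoning

  block-inom : ∀ x → block σ (inom σ x) ≡ lookup P (index x)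
  block-inom x = ⊆-antisym
    (λ {y} y∈ → subst (λ k → y ∈ lookup P k) (inom≡⇒index≡ (∈-block⇒inom σ (inom-weakExc σ x) y∈)) (∈-index y))
    (λ {y} y∈ → inom⇒∈-block σ (inom-weakExc σ x) (index≡⇒inom≡ (index-unique y∈)))

  block-σ : ∀ {i} → WeakExc σ i → block σ i ≡ lookup P (index (σ ⟨$⟩ʳ i))
  block-σ {i} i≤σi = trans (cong (block σ) (sym (inom-σ σ i≤σi))) (block-inom (σ ⟨$⟩ʳ i))

  block-∋ : ∀ {x B} → x ∈ B → B ∈ₗ P → block σ (inom σ x) ≡ B
  block-∋ {x} {B} x∈B B∈ = begin
    block σ (inom σ x)        ≡⟨ block-inom x ⟩
    lookup P (index x)        ≡⟨ cong (lookup P) (index-unique (subst (x ∈_) B≡ x∈B)) ⟩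
    lookup P (Any.index B∈)   ≡⟨ B≡ ⟨
    B                         ∎
    where
    open ≡-Reasoning
    B≡ : B ≡ lookup P (Any.index B∈)
    B≡ = Any.lookup-index B∈

  lam-samePartition : SamePartition (lam σ) P
  lam-samePartition = lam⊆P , P⊆lam
    where
    lam⊆P : ∀ B → B ∈ₗ lam σ → B ∈ₗ P
    lam⊆P B B∈ = case ∈-map⁻ (block σ) B∈ of λ where
      (i , i∈ , refl) → subst (_∈ₗ P) (sym (block-σ (weakExcs-weakExc σ i∈))) (∈-lookup (index (σ ⟨$⟩ʳ i)))
    P⊆lam : ∀ B → B ∈ₗ P → B ∈ₗ lam σ
    P⊆lam B B∈ = let x , x∈B = All.lookup nonempty B∈ in
      subst (_∈ₗ lam σ) (block-∋ x∈B B∈) (∈-map⁺ (block σ) (weakExc-∈-weakExcs σ (inom-weakExc σ x)))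

lam-surjective : ∀ {n} (P : List (Subset n)) → IsSetPartition P →
                 ∃ λ (σ : Permutation′ n) → InBP2 σ × SamePartition (lam σ) P
lam-surjective P P-partition = σ , σ-bp2 , lam-samePartition
  where open FromPartition P P-partition

mainTheorem4 : (n : ℕ) →
    ((σ : Permutation′ n) → InBP2 σ → IsSetPartition (lam σ))
    × ((σ τ : Permutation′ n) → InBP2 σ → InBP2 τ →
         SamePartition (lam σ) (lam τ) → ∀ (i : Fin n) → σ ⟨$⟩ʳ i ≡ τ ⟨$⟩ʳ i)
    × ((P : List (Subset n)) → IsSetPartition P →
         ∃ λ (σ : Permutation′ n) → InBP2 σ × SamePartition (lam σ) P)
mainTheorem4 n = (λ σ _ → lam-isSetPartition σ) , lam-injective , lam-surjective
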